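{- Assume the $abc$-conjecture is true. Fix an integer $c>1$. Then for all but finitely many pairs $(a,b)$ of integers $a,b>1$ such that $a,b,c$ are pairwise relatively prime, the equation \[ a^x+b^y=c^z \] has at most one solution $(x,y,z)$ in positive integers $x,y,z$.
   Context: The $abc$-conjecture is the statement: for every $\varepsilon>0$ there is a constant $K(\varepsilon)$ such that for all relatively prime positive integers $A,B,C$ with $A+B=C$ one has $C<K(\varepsilon)\,\mathrm{rad}(ABC)^{1+\varepsilon}$, where $\mathrm{rad}(n)$ denotes the product of the distinct primes dividing $n$. -}

module Defs where

open import Data.Nat using (ℕ; suc; _+_; _*_; _^_; _<_; _≤_)
open import Data.Nat.Divisibility using (_∣_; _∣?_)
open import Data.Nat.Primality using (Prime; prime?)
open import Data.Nat.Coprimality using (Coprime)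
open import Data.List using (List; filter; upTo)
open import Data.Nat.ListAction using (product)
open import Data.Product using (_×_; ∃)
open import Relation.Nullary.Decidable using (_×-dec_)
open import Relation.Binary.PropositionalEquality using (_≡_)

-- rad n = product of the distinct primes dividing n (primes are ≤ n for n ≥ 1)
rad : ℕ → ℕ
rad n = product (filter (λ p → prime? p ×-dec p ∣? n) (upTo (suc n)))

-- The abc-conjecture. A real ε > 0 is replaced by a rational ε = p/q (p,q ≥ 1),
-- and C < K·rad^(1+p/q) is written C^q < K^q · rad^(q+p); K is taken in ℕ.
ABC : Set
ABC = (p q : ℕ) → 1 ≤ p → 1 ≤ q →
      ∃ λ (K : ℕ) → (A B C : ℕ) → 1 ≤ A → 1 ≤ B → 1 ≤ C →
        Coprime A B → Coprime B C → Coprime A C → A + B ≡ C →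
        C ^ q < K ^ q * rad (A * B * C) ^ (q + p)

IsSol : ℕ → ℕ → ℕ → ℕ → ℕ → ℕ → Set
IsSol a b c x y z = 1 ≤ x × 1 ≤ y × 1 ≤ z × a ^ x + b ^ y ≡ c ^ z

AtMostOneSol : ℕ → ℕ → ℕ → Set
AtMostOneSol a b c = ∀ {x y z x′ y′ z′} → IsSol a b c x y z → IsSol a b c x′ y′ z′ →
                     x ≡ x′ × y ≡ y′ × z ≡ z′

module Submission where

-- Assume b < a. For a solution put C = c^z; abc with ε = 1/6 reads C^6 < K^6 (abc)^7, and this
-- forces a < (K^6 c^7)^6 as soon as a² ≤ C and b³ ≤ C. So for large a every solution has x ≤ 2,
-- and y ≤ 2 when x = 2. Two solutions with the same z then coincide by comparing sizes. If
-- z < z′, then c^z divides c^z′, and subtracting the two equations makes a power of c divide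
-- b^d − 1, a − 1, 2ab or 1 + b³, depending on the exponents. Each case either contradicts the sizes
-- directly or yields one more abc triple, 1 + m c^z = b^d or 1 + b³ = k c^z, which again
-- bounds a by a power of K^6 c^7. The exceptional pairs are those with a, b < (K^6 c^7)^6.

open import Defs
open import Data.Nat
  using (ℕ; zero; suc; _+_; _*_; _^_; _∸_; _≤_; _<_; z≤n; s≤s; z<s; NonZero; >-nonZero; >-nonZero⁻¹)
open import Data.Nat.Properties
open import Data.Nat.Divisibility
open import Data.Nat.Coprimality using (Coprime; coprime-divisor; coprime-+; 1-coprimeTo)
  renaming (sym to coprime-sym)
open import Data.Nat.Primality using (Prime; prime?; ¬prime[1]; euclidsLemma; prime⇒irreducible)
open import Data.Nat.Primality.Factorisation using (factorisationHasAllPrimeFactors)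
open import Data.Nat.ListAction using (product)
open import Data.Nat.Solver using (module +-*-Solver)
open import Data.List using (List; _∷_; []; filter; upTo; cartesianProduct)
open import Data.List.Relation.Unary.All as All using (All; []; _∷_)
open import Data.List.Relation.Unary.All.Properties using (all-filter; All¬⇒¬Any)
open import Data.List.Relation.Unary.AllPairs using (AllPairs; []; _∷_)
import Data.List.Relation.Unary.AllPairs.Properties as AllPairs
open import Data.List.Relation.Unary.Unique.Propositional.Properties using (upTo⁺)
open import Data.List.Membership.Propositional using (_∉_)
open import Data.List.Membership.Propositional.Properties using (∈-cartesianProduct⁺; ∈-upTo⁺)
open import Data.Product using (_×_; _,_; ∃; proj₁; proj₂)
open import Data.Sum using (_⊎_; inj₁; inj₂; [_,_]′)
open import Data.Empty using (⊥; ⊥-elim)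
open import Function using (id)
open import Relation.Nullary using (¬_; yes; no)
open import Relation.Nullary.Decidable using (_×-dec_)
open import Relation.Binary.Definitions using (tri<; tri≈; tri>)
open import Relation.Binary.PropositionalEquality

open +-*-Solver

private
  variable
    a b c i j k m n p q u v x y z x′ y′ z′ A B C K : ℕ

n≤n^[1+k] : ∀ n k → n ≤ n ^ suc k
n≤n^[1+k] zero k = z≤n
n≤n^[1+k] (suc n) k = m≤m*n (suc n) (suc n ^ k) {{m^n≢0 (suc n) k}}

^-cancelʳ-< : ∀ m .{{_ : NonZero m}} → m ^ i < m ^ j → i < j
^-cancelʳ-< {i} {j} m mⁱ<mʲ with i <? j
... | yes i<j = i<j
... | no i≮j = ⊥-elim (<⇒≱ mⁱ<mʲ (^-monoʳ-≤ m (≮⇒≥ i≮j)))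

^-injective : ∀ m → 1 < m → m ^ i ≡ m ^ j → i ≡ j
^-injective {i} {j} m 1<m eq with <-cmp i j
... | tri< i<j _ _ = ⊥-elim (<-irrefl eq (^-monoʳ-< m 1<m i<j))
... | tri≈ _ i≡j _ = i≡j
... | tri> _ _ i>j = ⊥-elim (<-irrefl (sym eq) (^-monoʳ-< m 1<m i>j))

^-monoʳ-∣ : ∀ m → i ≤ j → m ^ i ∣ m ^ j
^-monoʳ-∣ {i} {j} m i≤j = divides (m ^ (j ∸ i)) (begin
  m ^ j                 ≡⟨ cong (m ^_) (sym (m+[n∸m]≡n i≤j)) ⟩
  m ^ (i + (j ∸ i))     ≡⟨ ^-distribˡ-+-* m i (j ∸ i) ⟩
  m ^ i * m ^ (j ∸ i)   ≡⟨ *-comm (m ^ i) _ ⟩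
  m ^ (j ∸ i) * m ^ i   ∎)
  where open ≡-Reasoning

m^i+m^i≤m^j : ∀ m → 1 < m → i < j → m ^ i + m ^ i ≤ m ^ j
m^i+m^i≤m^j {i} {j} m 1<m i<j = begin
  m ^ i + m ^ i    ≡⟨ cong (m ^ i +_) (+-identityʳ (m ^ i)) ⟨
  2 * m ^ i        ≤⟨ *-monoˡ-≤ (m ^ i) 1<m ⟩
  m ^ suc i        ≤⟨ ^-monoʳ-≤ m {{>-nonZero (<-trans z<s 1<m)}} i<j ⟩
  m ^ j            ∎
  where open ≤-Reasoning

1+m*n≡k⇒n<k : 1 + m * n ≡ k → 1 < k → n < k
1+m*n≡k⇒n<k {zero} refl (s≤s ())
1+m*n≡k⇒n<k {suc m} {n} refl _ = s≤s (m≤m+n n (m * n))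

1+m*n≡k⇒m≢0 : 1 + m * n ≡ k → 1 < k → NonZero m
1+m*n≡k⇒m≢0 {zero} refl (s≤s ())
1+m*n≡k⇒m≢0 {suc m} _ _ = _

n<m^[1+i]⇒n<m^[1+j] : ∀ m → n < m ^ suc i → i ≤ j → n < m ^ suc j
n<m^[1+i]⇒n<m^[1+j] zero () _
n<m^[1+i]⇒n<m^[1+j] (suc m) n<mⁱ i≤j = <-≤-trans n<mⁱ (^-monoʳ-≤ (suc m) (s≤s i≤j))

1≤n<3 : 1 ≤ n → n < 3 → n ≡ 1 ⊎ n ≡ 2
1≤n<3 {1} _ _ = inj₁ refl
1≤n<3 {2} _ _ = inj₂ refl
1≤n<3 {suc (suc (suc _))} _ (s≤s (s≤s (s≤s ())))

1≤m<n<3 : 1 ≤ m → m < n → n < 3 → m ≡ 1 × n ≡ 2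
1≤m<n<3 1≤m m<n n<3 with 1≤n<3 (≤-trans 1≤m (<⇒≤ m<n)) n<3
... | inj₁ refl = ⊥-elim (<⇒≱ m<n 1≤m)
... | inj₂ refl = ≤-antisym (≤-pred m<n) 1≤m , refl

a+b²<a²+b : 1 ≤ b → b < a → a ^ 1 + b ^ 2 < a ^ 2 + b ^ 1
a+b²<a²+b {b} {suc a′} 1≤b (s≤s b≤a′) = begin-strict
  suc a′ ^ 1 + b ^ 2          ≡⟨ solve 2 (λ a′ b → (con 1 :+ a′) :^ 1 :+ b :^ 2
                                  := con 1 :+ a′ :+ b :* b) refl a′ b ⟩
  suc a′ + b * b              ≤⟨ +-monoʳ-≤ (suc a′) (*-mono-≤ b≤a′ b≤a′) ⟩
  suc a′ + a′ * a′            <⟨ m<m+n (suc a′ + a′ * a′) (≤-trans 1≤b (m≤n+m b a′)) ⟩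
  suc a′ + a′ * a′ + (a′ + b) ≡⟨ solve 2 (λ a′ b → con 1 :+ a′ :+ a′ :* a′ :+ (a′ :+ b)
                                  := (con 1 :+ a′) :^ 2 :+ b :^ 1) refl a′ b ⟩
  suc a′ ^ 2 + b ^ 1          ∎
  where open ≤-Reasoning

coprime-*ˡ : Coprime m n → Coprime k n → Coprime (m * k) n
coprime-*ˡ {m} {n} {k} m⊥n k⊥n {d} (d∣mk , d∣n) = m⊥n (d∣m , d∣n)
  where
  d⊥k : Coprime d k
  d⊥k (e∣d , e∣k) = k⊥n (e∣k , ∣-trans e∣d d∣n)
  d∣m : d ∣ m
  d∣m = coprime-divisor d⊥k (subst (d ∣_) (*-comm m k) d∣mk)

coprime-^ˡ : ∀ i → Coprime m n → Coprime (m ^ i) n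
coprime-^ˡ {n = n} zero _ = 1-coprimeTo n
coprime-^ˡ (suc i) m⊥n = coprime-*ˡ m⊥n (coprime-^ˡ i m⊥n)

coprime-^ : ∀ i j → Coprime m n → Coprime (m ^ i) (n ^ j)
coprime-^ i j m⊥n = coprime-^ˡ i (coprime-sym (coprime-^ˡ j (coprime-sym m⊥n)))

coprime-+ˡ : Coprime A B → Coprime A (A + B)
coprime-+ˡ A⊥B = coprime-sym (coprime-+ (coprime-sym A⊥B))

coprime-+ʳ : Coprime A B → Coprime B (A + B)
coprime-+ʳ {A} {B} A⊥B = subst (Coprime B) (+-comm B A) (coprime-sym (coprime-+ A⊥B))

coprime-*-∣ : Coprime m n → m ∣ k → n ∣ k → m * n ∣ k
coprime-*-∣ {m} {n} m⊥n m∣k (divides q refl) =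
  *-monoˡ-∣ n (coprime-divisor m⊥n (subst (m ∣_) (*-comm q n) m∣k))

^[j∸i]≡1+m*P : ∀ {P R} u .{{_ : NonZero u}} → Coprime u P → P ∣ R → i ≤ j →
  v + u ^ i ≡ P → v + u ^ j ≡ R → ∃ λ m → 1 + m * P ≡ u ^ (j ∸ i)
^[j∸i]≡1+m*P {i} {j} {v} {P} {R} u u⊥P P∣R i≤j vuⁱ≡P vuʲ≡R =
  quotient P∣t , trans (cong (1 +_) (sym (m∣n⇒n≡quotient*m P∣t))) uᵈ≡1+t
  where
  d = j ∸ i
  t = u ^ d ∸ 1
  uᵈ≡1+t : 1 + t ≡ u ^ d
  uᵈ≡1+t = m+[n∸m]≡n (m^n>0 u d)
  R≡P+uⁱt : R ≡ P + u ^ i * t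
  R≡P+uⁱt = begin
    R                        ≡⟨ vuʲ≡R ⟨
    v + u ^ j                ≡⟨ cong (λ e → v + u ^ e) (m+[n∸m]≡n i≤j) ⟨
    v + u ^ (i + d)          ≡⟨ cong (v +_) (^-distribˡ-+-* u i d) ⟩
    v + u ^ i * u ^ d        ≡⟨ cong (λ e → v + u ^ i * e) uᵈ≡1+t ⟨
    v + u ^ i * (1 + t)      ≡⟨ solve 3 (λ v w t → v :+ w :* (con 1 :+ t) := v :+ w :+ w :* t) refl v (u ^ i) t ⟩
    v + u ^ i + u ^ i * t    ≡⟨ cong (_+ u ^ i * t) vuⁱ≡P ⟩
    P + u ^ i * t            ∎
    where open ≡-Reasoning
  P∣t : P ∣ t
  P∣t = coprime-divisor (coprime-sym (coprime-^ˡ i u⊥P))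
          (∣m+n∣m⇒∣n (subst (P ∣_) R≡P+uⁱt P∣R) ∣-refl)

-- every prime factor of m divides n; for n ≢ 0 this says rad m ∣ n
infix 4 _⊆ₚ_
_⊆ₚ_ : ℕ → ℕ → Set
m ⊆ₚ n = ∀ {p} → Prime p → p ∣ m → p ∣ n

⊆ₚ-refl : m ⊆ₚ m
⊆ₚ-refl _ p∣m = p∣m

^-⊆ₚ : ∀ m i → m ^ i ⊆ₚ m
^-⊆ₚ m zero p-prime p∣1 = ⊥-elim (¬prime[1] (subst Prime (∣1⇒≡1 p∣1) p-prime))
^-⊆ₚ m (suc i) p-prime p∣mᵢ₊₁ with euclidsLemma m (m ^ i) p-prime p∣mᵢ₊₁
... | inj₁ p∣m = p∣m
... | inj₂ p∣mⁱ = ^-⊆ₚ m i p-prime p∣mⁱ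

*-⊆ₚ : m ⊆ₚ u → n ⊆ₚ v → m * n ⊆ₚ u * v
*-⊆ₚ {m} {u} {n} {v} m⊆u n⊆v p-prime p∣mn with euclidsLemma m n p-prime p∣mn
... | inj₁ p∣m = ∣-trans (m⊆u p-prime p∣m) (m∣m*n v)
... | inj₂ p∣n = ∣-trans (n⊆v p-prime p∣n) (n∣m*n u)

prime∤⇒coprime : Prime p → ¬ p ∣ n → Coprime p n
prime∤⇒coprime p-prime p∤n (d∣p , d∣n) with prime⇒irreducible p-prime d∣p
... | inj₁ d≡1 = d≡1
... | inj₂ refl = ⊥-elim (p∤n d∣n)

product-∣ : ∀ {ps} → AllPairs _≢_ ps → All (λ p → Prime p × p ∣ n) ps → product ps ∣ n
product-∣ [] [] = 1∣ _
product-∣ (p∉ps ∷ distinct) ((p-prime , p∣n) ∷ prime-divisors) =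
  coprime-*-∣ (prime∤⇒coprime p-prime p∤Πps) p∣n (product-∣ distinct prime-divisors)
  where
  p∤Πps = λ p∣Πps → All¬⇒¬Any p∉ps
    (factorisationHasAllPrimeFactors p-prime p∣Πps (All.map proj₁ prime-divisors))

rad-∣ : m ⊆ₚ n → rad m ∣ n
rad-∣ {m} m⊆n = product-∣ (AllPairs.filter⁺ P? (upTo⁺ (suc m)))
  (All.map (λ (p-prime , p∣m) → p-prime , m⊆n p-prime p∣m) (all-filter P? (upTo (suc m))))
  where P? = λ p → prime? p ×-dec p ∣? m

RadicalAbc : ℕ → ℕ → ℕ → Set
RadicalAbc p q K = ∀ {A B C a b c} .{{_ : NonZero a}} .{{_ : NonZero b}} .{{_ : NonZero c}} →
  1 ≤ A → 1 ≤ B → Coprime A B → A + B ≡ C → A ⊆ₚ a → B ⊆ₚ b → C ⊆ₚ c →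
  C ^ q < K ^ q * (a * b * c) ^ (q + p)

abc⇒radicalAbc : ABC → ∀ p q → 1 ≤ p → 1 ≤ q → ∃ (RadicalAbc p q)
abc⇒radicalAbc abc p q 1≤p 1≤q = K₀ , bound
  where
  K₀ = proj₁ (abc p q 1≤p 1≤q)
  bound : RadicalAbc p q K₀
  bound {A} {B} {_} {a} {b} {c} 1≤A 1≤B A⊥B refl A⊆a B⊆b C⊆c =
    <-≤-trans (proj₂ (abc p q 1≤p 1≤q) A B (A + B) 1≤A 1≤B (≤-trans 1≤A (m≤m+n A B))
                 A⊥B (coprime-+ʳ A⊥B) (coprime-+ˡ A⊥B) refl)
              (*-monoʳ-≤ (K₀ ^ q) (^-monoˡ-≤ (q + p) rad≤abc))
    where
    instance
      ab≢0 = m*n≢0 a b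
      abc≢0 = m*n≢0 (a * b) c
    rad≤abc : rad (A * B * (A + B)) ≤ a * b * c
    rad≤abc = ∣⇒≤ (rad-∣ (*-⊆ₚ (*-⊆ₚ A⊆a B⊆b) C⊆c))

radicalAbc-unit : RadicalAbc p q K → .{{_ : NonZero b}} .{{_ : NonZero c}} →
  1 ≤ B → 1 + B ≡ C → B ⊆ₚ b → C ⊆ₚ c → C ^ q < K ^ q * (b * c) ^ (q + p)
radicalAbc-unit {p} {q} {K} {b} {c} {B} {C} abc 1≤B eq B⊆b C⊆c =
  subst (λ r → C ^ q < K ^ q * r ^ (q + p)) (cong (_* c) (*-identityˡ b))
    (abc ≤-refl 1≤B (1-coprimeTo B) eq ⊆ₚ-refl B⊆b C⊆c)

a²≤∧b³≤⇒a< : a ^ 2 ≤ C → b ^ 3 ≤ C → C ^ 6 < K ^ 6 * (a * b * c) ^ 7 → a < (K ^ 6 * c ^ 7) ^ 6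
a²≤∧b³≤⇒a< {a} {C} {b} {K} {c} a²≤C b³≤C C⁶<K⁶[abc]⁷ =
  ≤-<-trans (≤-trans (n≤n^[1+k] a 1) a²≤C) C<X⁶
  where
  open ≤-Reasoning
  X = K ^ 6 * c ^ 7
  [ab]⁶≤C⁵ : (a * b) ^ 6 ≤ C ^ 5
  [ab]⁶≤C⁵ = begin
    (a * b) ^ 6                ≡⟨ solve 2 (λ a b → (a :* b) :^ 6 := (a :^ 2) :^ 3 :* (b :^ 3) :^ 2) refl a b ⟩
    (a ^ 2) ^ 3 * (b ^ 3) ^ 2  ≤⟨ *-mono-≤ (^-monoˡ-≤ 3 a²≤C) (^-monoˡ-≤ 2 b³≤C) ⟩
    C ^ 3 * C ^ 2              ≡⟨ solve 1 (λ C → C :^ 3 :* C :^ 2 := C :^ 5) refl C ⟩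
    C ^ 5                      ∎
  C<Xab : C < X * (a * b)
  C<Xab = *-cancelʳ-< (C ^ 5) C (X * (a * b)) (begin-strict
    C ^ 6                          <⟨ C⁶<K⁶[abc]⁷ ⟩
    K ^ 6 * (a * b * c) ^ 7        ≡⟨ solve 4 (λ K a b c → K :^ 6 :* (a :* b :* c) :^ 7
                                        := K :^ 6 :* c :^ 7 :* (a :* b) :* (a :* b) :^ 6) refl K a b c ⟩
    X * (a * b) * (a * b) ^ 6      ≤⟨ *-monoʳ-≤ (X * (a * b)) [ab]⁶≤C⁵ ⟩
    X * (a * b) * C ^ 5            ∎)
  C<X⁶ : C < X ^ 6
  C<X⁶ = *-cancelʳ-< (C ^ 5) C (X ^ 6) (begin-strict
    C ^ 6                <⟨ ^-monoˡ-< 6 C<Xab ⟩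
    (X * (a * b)) ^ 6    ≡⟨ solve 2 (λ X ab → (X :* ab) :^ 6 := X :^ 6 :* ab :^ 6) refl X (a * b) ⟩
    X ^ 6 * (a * b) ^ 6  ≤⟨ *-monoʳ-≤ (X ^ 6) [ab]⁶≤C⁵ ⟩
    X ^ 6 * C ^ 5        ∎)

-- The two abc estimates of the case x = x′ = 1: P = c^z, Q = b^d = 1 + m P and R = c^z′ ≥ b Q.
m*P≤Q⇒P⁷< : ∀ {P Q} .{{_ : NonZero P}} → m * P ≤ Q → Q ^ 6 < K ^ 6 * (m * c * b) ^ 7 →
  P ^ 7 < K ^ 6 * (b * c) ^ 7 * Q
m*P≤Q⇒P⁷< {m} {K} {c} {b} {P} {Q} mP≤Q Q⁶< = *-cancelʳ-< (Q ^ 6) (P ^ 7) (Y * Q) (begin-strict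
  P ^ 7 * Q ^ 6                ≡⟨ *-comm (P ^ 7) (Q ^ 6) ⟩
  Q ^ 6 * P ^ 7                <⟨ *-monoˡ-< (P ^ 7) {{m^n≢0 P 7}} Q⁶< ⟩
  K ^ 6 * (m * c * b) ^ 7 * P ^ 7
    ≡⟨ solve 5 (λ K m c b P → K :^ 6 :* (m :* c :* b) :^ 7 :* P :^ 7
                 := K :^ 6 :* (b :* c) :^ 7 :* (m :* P) :^ 7) refl K m c b P ⟩
  Y * (m * P) ^ 7              ≤⟨ *-monoʳ-≤ Y (^-monoˡ-≤ 7 mP≤Q) ⟩
  Y * Q ^ 7                    ≡⟨ *-assoc Y Q (Q ^ 6) ⟨
  Y * Q * Q ^ 6                ∎)
  where
  open ≤-Reasoning
  Y = K ^ 6 * (b * c) ^ 7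

b*Q≤R⇒Q< : ∀ {P Q R} → a ≤ P → b ^ 2 ≤ Q → b * Q ≤ R → R ^ 6 < K ^ 6 * (a * b * c) ^ 7 →
  P ^ 7 < K ^ 6 * (b * c) ^ 7 * Q → Q < (K ^ 6 * c ^ 7) ^ 2
b*Q≤R⇒Q< {a} {b} {K} {c} {P} {Q} {R} a≤P b²≤Q bQ≤R R⁶< P⁷< =
  *-cancelʳ-< (b ^ 14 * Q) Q ((K ^ 6 * c ^ 7) ^ 2) (begin-strict
    Q * (b ^ 14 * Q)              ≡⟨ solve 2 (λ b Q → Q :* (b :^ 14 :* Q)
                                       := b :^ 6 :* (b :^ 2) :^ 4 :* Q :^ 2) refl b Q ⟩
    b ^ 6 * (b ^ 2) ^ 4 * Q ^ 2   ≤⟨ *-monoˡ-≤ (Q ^ 2) (*-monoʳ-≤ (b ^ 6) (^-monoˡ-≤ 4 b²≤Q)) ⟩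
    b ^ 6 * Q ^ 4 * Q ^ 2         ≡⟨ solve 2 (λ b Q → b :^ 6 :* Q :^ 4 :* Q :^ 2 := (b :* Q) :^ 6) refl b Q ⟩
    (b * Q) ^ 6                   ≤⟨ ^-monoˡ-≤ 6 bQ≤R ⟩
    R ^ 6                         <⟨ R⁶< ⟩
    K ^ 6 * (a * b * c) ^ 7       ≤⟨ *-monoʳ-≤ (K ^ 6) (^-monoˡ-≤ 7 (*-monoˡ-≤ c (*-monoˡ-≤ b a≤P))) ⟩
    K ^ 6 * (P * b * c) ^ 7       ≡⟨ solve 4 (λ K P b c → K :^ 6 :* (P :* b :* c) :^ 7
                                       := K :^ 6 :* (b :* c) :^ 7 :* P :^ 7) refl K P b c ⟩
    Y * P ^ 7                     ≤⟨ *-monoʳ-≤ Y (<⇒≤ P⁷<) ⟩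
    Y * (Y * Q)                   ≡⟨ solve 4 (λ K b c Q → K :^ 6 :* (b :* c) :^ 7 :* (K :^ 6 :* (b :* c) :^ 7 :* Q)
                                       := (K :^ 6 :* c :^ 7) :^ 2 :* (b :^ 14 :* Q)) refl K b c Q ⟩
    (K ^ 6 * c ^ 7) ^ 2 * (b ^ 14 * Q) ∎)
  where
  open ≤-Reasoning
  Y = K ^ 6 * (b * c) ^ 7

1+b³≡k*P⇒b< : ∀ {P} → 1 + b ^ 3 ≡ k * P → k ≤ b → (k * P) ^ 6 < K ^ 6 * (b * (k * c)) ^ 7 →
  b < K ^ 6 * c ^ 7
1+b³≡k*P⇒b< {b} {k} {K} {c} {P} 1+b³≡kP k≤b [kP]⁶< =
  *-cancelʳ-< (b ^ 14) b (K ^ 6 * c ^ 7) (begin-strict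
    b * b ^ 14                   ≤⟨ *-monoˡ-≤ (b ^ 14) (n≤n^[1+k] b 3) ⟩
    b ^ 4 * b ^ 14               ≡⟨ solve 1 (λ b → b :^ 4 :* b :^ 14 := (b :^ 3) :^ 6) refl b ⟩
    (b ^ 3) ^ 6                  <⟨ ^-monoˡ-< 6 (n<1+n (b ^ 3)) ⟩
    (1 + b ^ 3) ^ 6              ≡⟨ cong (_^ 6) 1+b³≡kP ⟩
    (k * P) ^ 6                  <⟨ [kP]⁶< ⟩
    K ^ 6 * (b * (k * c)) ^ 7    ≤⟨ *-monoʳ-≤ (K ^ 6) (^-monoˡ-≤ 7 (*-monoʳ-≤ b (*-monoˡ-≤ c k≤b))) ⟩
    K ^ 6 * (b * (b * c)) ^ 7    ≡⟨ solve 3 (λ K b c → K :^ 6 :* (b :* (b :* c)) :^ 7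
                                      := K :^ 6 :* c :^ 7 :* b :^ 14) refl K b c ⟩
    K ^ 6 * c ^ 7 * b ^ 14       ∎)
  where open ≤-Reasoning

module _ {K a b c : ℕ} (abc : RadicalAbc 1 6 K) (1<c : 1 < c) (1<b : 1 < b) (b<a : b < a)
         (a⊥b : Coprime a b) (b⊥c : Coprime b c) (a⊥c : Coprime a c)
         (large : (K ^ 6 * c ^ 7) ^ 6 ≤ a) where

  private
    instance
      a≢0 : NonZero a
      a≢0 = >-nonZero (<-trans z<s (<-trans 1<b b<a))
      b≢0 : NonZero b
      b≢0 = >-nonZero (<-trans z<s 1<b)
      c≢0 : NonZero c
      c≢0 = >-nonZero (<-trans z<s 1<c)

    X : ℕ
    X = K ^ 6 * c ^ 7

    Sol : ℕ → ℕ → ℕ → Set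
    Sol = IsSol a b c

  abc-unit : ∀ {B C u v} .{{_ : NonZero u}} .{{_ : NonZero v}} →
    1 ≤ B → 1 + B ≡ C → B ⊆ₚ u → C ⊆ₚ v → C ^ 6 < K ^ 6 * (u * v) ^ 7
  abc-unit = radicalAbc-unit {1} {6} {K} abc

  a≮X^ : a < X ^ suc i → i ≤ 5 → ⊥
  a≮X^ a<Xⁱ i≤5 = <⇒≱ (n<m^[1+i]⇒n<m^[1+j] X a<Xⁱ i≤5) large

  aˣ≤cᶻ : Sol x y z → a ^ x ≤ c ^ z
  aˣ≤cᶻ {x} {y} (_ , _ , _ , eq) = subst (a ^ x ≤_) eq (m≤m+n (a ^ x) (b ^ y))

  bʸ≤cᶻ : Sol x y z → b ^ y ≤ c ^ z
  bʸ≤cᶻ {x} {y} (_ , _ , _ , eq) = subst (b ^ y ≤_) eq (m≤n+m (b ^ y) (a ^ x))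

  a<cᶻ : Sol 1 y z → a < c ^ z
  a<cᶻ {y} (_ , _ , _ , eq) =
    subst₂ _<_ (^-identityʳ a) eq (m<m+n (a ^ 1) (m^n>0 b y))

  abc-bound : Sol x y z → (c ^ z) ^ 6 < K ^ 6 * (a * b * c) ^ 7
  abc-bound {x} {y} {z} (_ , _ , _ , eq) =
    abc (m^n>0 a x) (m^n>0 b y) (coprime-^ x y a⊥b) eq (^-⊆ₚ a x) (^-⊆ₚ b y) (^-⊆ₚ c z)

  cᶻ<a²⊎cᶻ<b³ : Sol x y z → c ^ z < a ^ 2 ⊎ c ^ z < b ^ 3
  cᶻ<a²⊎cᶻ<b³ {z = z} s with a ^ 2 ≤? c ^ z | b ^ 3 ≤? c ^ z
  ... | no a²≰cᶻ | _        = inj₁ (≰⇒> a²≰cᶻ)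
  ... | yes _    | no b³≰cᶻ = inj₂ (≰⇒> b³≰cᶻ)
  ... | yes a²≤cᶻ | yes b³≤cᶻ =
    ⊥-elim (a≮X^ (a²≤∧b³≤⇒a< {b = b} {K = K} {c = c} a²≤cᶻ b³≤cᶻ (abc-bound s)) ≤-refl)

  x<3 : Sol x y z → x < 3
  x<3 s = ^-cancelʳ-< a (≤-<-trans (aˣ≤cᶻ s) cᶻ<a³)
    where
    cᶻ<a³ = [ (λ cᶻ<a² → <-≤-trans cᶻ<a² (^-monoʳ-≤ a (n≤1+n 2)))
            , (λ cᶻ<b³ → <-trans cᶻ<b³ (^-monoˡ-< 3 b<a)) ]′ (cᶻ<a²⊎cᶻ<b³ s)

  x≡1⊎x≡2 : Sol x y z → x ≡ 1 ⊎ x ≡ 2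
  x≡1⊎x≡2 s@(1≤x , _) = 1≤n<3 1≤x (x<3 s)

  bʷ≤cᶻ⇒w<3 : ∀ {w} → Sol x y z → a ^ 2 ≤ c ^ z → b ^ w ≤ c ^ z → w < 3
  bʷ≤cᶻ⇒w<3 s a²≤cᶻ bʷ≤cᶻ = ^-cancelʳ-< b (≤-<-trans bʷ≤cᶻ cᶻ<b³)
    where
    cᶻ<b³ = [ (λ cᶻ<a² → ⊥-elim (<⇒≱ cᶻ<a² a²≤cᶻ)) , (λ cᶻ<b³ → cᶻ<b³) ]′ (cᶻ<a²⊎cᶻ<b³ s)

  same-x⇒same-y : Sol x y z → Sol x y′ z → y ≡ y′
  same-x⇒same-y {x} (_ , _ , _ , eq) (_ , _ , _ , eq′) =
    ^-injective b 1<b (+-cancelˡ-≡ (a ^ x) _ _ (trans eq (sym eq′)))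

  -- The brackets in same-z⇒⊥[…] and z<z′⇒⊥[…] give the exponent of a, or the exponents of a
  -- and b, in the two solutions.
  same-z⇒⊥[1,2] : Sol 1 y z → Sol 2 y′ z → ⊥
  same-z⇒⊥[1,2] {y} {z} {y′} s@(_ , 1≤y , _ , eq) s′@(_ , 1≤y′ , _ , eq′)
    with 1≤n<3 1≤y (bʷ≤cᶻ⇒w<3 s′ (aˣ≤cᶻ s′) (bʸ≤cᶻ s))
  ... | inj₁ refl = <-irrefl (trans eq (sym eq′))
                      (+-mono-<-≤ (^-monoʳ-< a (<-trans 1<b b<a) (n<1+n 1)) (^-monoʳ-≤ b 1≤y′))
  ... | inj₂ refl = <-irrefl (trans eq (sym eq′))
                      (<-≤-trans (a+b²<a²+b (<⇒≤ 1<b) b<a) (+-monoʳ-≤ (a ^ 2) (^-monoʳ-≤ b 1≤y′)))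

  same-z : Sol x y z → Sol x′ y′ z → x ≡ x′ × y ≡ y′
  same-z s s′ with x≡1⊎x≡2 s | x≡1⊎x≡2 s′
  ... | inj₁ refl | inj₁ refl = refl , same-x⇒same-y s s′
  ... | inj₂ refl | inj₂ refl = refl , same-x⇒same-y s s′
  ... | inj₁ refl | inj₂ refl = ⊥-elim (same-z⇒⊥[1,2] s s′)
  ... | inj₂ refl | inj₁ refl = ⊥-elim (same-z⇒⊥[1,2] s′ s)

  a⊥cᶻ : ∀ z → Coprime a (c ^ z)
  a⊥cᶻ z = coprime-sym (coprime-^ˡ z (coprime-sym a⊥c))

  b⊥cᶻ : ∀ z → Coprime b (c ^ z)
  b⊥cᶻ z = coprime-sym (coprime-^ˡ z (coprime-sym b⊥c))

  z<z′⇒y<y′ : Sol x y z → Sol x y′ z′ → z < z′ → y < y′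
  z<z′⇒y<y′ {x} (_ , _ , _ , eq) (_ , _ , _ , eq′) z<z′ =
    ^-cancelʳ-< b (+-cancelˡ-< (a ^ x) _ _ (subst₂ _<_ (sym eq) (sym eq′) (^-monoʳ-< c 1<c z<z′)))

  z<z′⇒⊥[2,2] : Sol 2 y z → Sol 2 y′ z′ → z < z′ → ⊥
  z<z′⇒⊥[2,2] {z = z} s@(_ , 1≤y , _ , eq) s′@(_ , _ , _ , eq′) z<z′
    with 1≤m<n<3 1≤y (z<z′⇒y<y′ s s′ z<z′) (bʷ≤cᶻ⇒w<3 s′ (aˣ≤cᶻ s′) (bʸ≤cᶻ s′))
  ... | refl , refl
    with ^[j∸i]≡1+m*P {i = 1} {j = 2} b (b⊥cᶻ z) (^-monoʳ-∣ c (<⇒≤ z<z′)) (s≤s z≤n) eq eq′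
  ... | m , 1+m*cᶻ≡b = <⇒≱ (1+m*n≡k⇒n<k {m} 1+m*cᶻ≡b (^-monoʳ-< b 1<b {0} {1} z<s)) (bʸ≤cᶻ s)

  z<z′⇒⊥[2,1] : Sol 2 y z → Sol 1 y′ z′ → z < z′ → ⊥
  z<z′⇒⊥[2,1] {y} {z} {y′} {z′} s@(_ , _ , _ , eq) s′@(_ , _ , _ , eq′) z<z′ = <⇒≱ a²<bʸ′ bʸ′≤a²
    where
    a²<cᶻ : a ^ 2 < c ^ z
    a²<cᶻ = subst (a ^ 2 <_) eq (m<m+n (a ^ 2) (m^n>0 b y))
    bʸ′≤a² : b ^ y′ ≤ a ^ 2
    bʸ′≤a² = ≤-trans (^-monoʳ-≤ b y′≤2) (^-monoˡ-≤ 2 (<⇒≤ b<a))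
      where
      y′≤2 : y′ ≤ 2
      y′≤2 = ≤-pred (bʷ≤cᶻ⇒w<3 s′ (≤-trans (<⇒≤ a²<cᶻ) (^-monoʳ-≤ c (<⇒≤ z<z′))) (bʸ≤cᶻ s′))
    a²<bʸ′ : a ^ 2 < b ^ y′
    a²<bʸ′ = +-cancelˡ-< (a ^ 1) _ _ (begin-strict
      a ^ 1 + a ^ 2     <⟨ +-mono-< (≤-<-trans (^-monoʳ-≤ a {1} {2} (s≤s z≤n)) a²<cᶻ) a²<cᶻ ⟩
      c ^ z + c ^ z     ≤⟨ m^i+m^i≤m^j c 1<c z<z′ ⟩
      c ^ z′            ≡⟨ eq′ ⟨
      a ^ 1 + b ^ y′    ∎)
      where open ≤-Reasoning

  z<z′⇒⊥[1,1] : Sol 1 y z → Sol 1 y′ z′ → z < z′ → ⊥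
  z<z′⇒⊥[1,1] {y} {z} {y′} {z′} s@(_ , 1≤y , _ , eq) s′@(_ , _ , _ , eq′) z<z′
    with ^[j∸i]≡1+m*P b (b⊥cᶻ z) (^-monoʳ-∣ c (<⇒≤ z<z′)) (<⇒≤ (z<z′⇒y<y′ s s′ z<z′)) eq eq′
  ... | m , 1+m*P≡Q = a≮X^ {1} (<-trans a<P (<-trans P<Q Q<X²)) (s≤s z≤n)
    where
    P = c ^ z
    R = c ^ z′
    y<y′ = z<z′⇒y<y′ s s′ z<z′
    d = y′ ∸ y
    Q = b ^ d
    a<P : a < P
    a<P = a<cᶻ s
    1<Q : 1 < Q
    1<Q = ^-monoʳ-< b 1<b {0} {d} (m<n⇒0<n∸m y<y′)
    P<Q : P < Q
    P<Q = 1+m*n≡k⇒n<k {m} 1+m*P≡Q 1<Q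
    b²≤Q : b ^ 2 ≤ Q
    b²≤Q = ^-monoʳ-≤ b (^-cancelʳ-< {1} {d} b
             (subst (_< Q) (sym (^-identityʳ b)) (<-trans b<a (<-trans a<P P<Q))))
    bQ≤R : b * Q ≤ R
    bQ≤R = begin
      b * Q           ≤⟨ *-monoˡ-≤ Q (subst (_≤ b ^ y) (^-identityʳ b) (^-monoʳ-≤ b 1≤y)) ⟩
      b ^ y * b ^ d   ≡⟨ ^-distribˡ-+-* b y d ⟨
      b ^ (y + d)     ≡⟨ cong (b ^_) (m+[n∸m]≡n (<⇒≤ y<y′)) ⟩
      b ^ y′          ≤⟨ bʸ≤cᶻ s′ ⟩
      R               ∎
      where open ≤-Reasoning
    instance
      m≢0 : NonZero m
      m≢0 = 1+m*n≡k⇒m≢0 {m} 1+m*P≡Q 1<Q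
      P≢0 : NonZero P
      P≢0 = m^n≢0 c z
    Q⁶< : Q ^ 6 < K ^ 6 * (m * c * b) ^ 7
    Q⁶< = abc-unit {{m*n≢0 m c}} (>-nonZero⁻¹ (m * P) {{m*n≢0 m P}}) 1+m*P≡Q
            (*-⊆ₚ (⊆ₚ-refl {m}) (^-⊆ₚ c z)) (^-⊆ₚ b d)
    Q<X² : Q < X ^ 2
    Q<X² = b*Q≤R⇒Q< {a} {b} {K} {c} {P} {Q} {R} (<⇒≤ a<P) b²≤Q bQ≤R (abc-bound s′)
             (m*P≤Q⇒P⁷< {m} {K} {c} {b} {P} {Q} (subst (m * P ≤_) 1+m*P≡Q (n≤1+n (m * P)))
               Q⁶<)

  z<z′⇒⊥[1y,2y] : Sol 1 y z → Sol 2 y z′ → z < z′ → ⊥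
  z<z′⇒⊥[1y,2y] {y} {z} s@(_ , _ , _ , eq) (_ , _ , _ , eq′) z<z′
    with ^[j∸i]≡1+m*P {1} {2} {b ^ y} a (a⊥cᶻ z) (^-monoʳ-∣ c (<⇒≤ z<z′)) (s≤s z≤n)
           (trans (+-comm (b ^ y) (a ^ 1)) eq) (trans (+-comm (b ^ y) (a ^ 2)) eq′)
  ... | m , 1+m*cᶻ≡a =
    <⇒≱ (1+m*n≡k⇒n<k {m} 1+m*cᶻ≡a (^-monoʳ-< a (<-trans 1<b b<a) {0} {1} z<s)) (aˣ≤cᶻ s)

  [cᶻ]²≡cᶻ′+2ab : Sol 1 1 z → Sol 2 2 z′ → c ^ z * c ^ z ≡ c ^ z′ + a * b * 2
  [cᶻ]²≡cᶻ′+2ab {z} {z′} (_ , _ , _ , eq) (_ , _ , _ , eq′) = begin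
    c ^ z * c ^ z                        ≡⟨ cong₂ _*_ eq eq ⟨
    (a ^ 1 + b ^ 1) * (a ^ 1 + b ^ 1)    ≡⟨ solve 2 (λ a b → (a :^ 1 :+ b :^ 1) :* (a :^ 1 :+ b :^ 1)
                                              := a :^ 2 :+ b :^ 2 :+ a :* b :* con 2) refl a b ⟩
    a ^ 2 + b ^ 2 + a * b * 2            ≡⟨ cong (_+ a * b * 2) eq′ ⟩
    c ^ z′ + a * b * 2                   ∎
    where open ≡-Reasoning

  z<z′⇒⊥[11,22] : Sol 1 1 z → Sol 2 2 z′ → z < z′ → ⊥
  z<z′⇒⊥[11,22] {z} {z′} s s′ _ with ≤-total (z + z) z′
  ... | inj₁ 2z≤z′ = <⇒≱ (m<m+n (c ^ z′) 0<2ab) (begin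
      c ^ z′ + a * b * 2   ≡⟨ [cᶻ]²≡cᶻ′+2ab s s′ ⟨
      c ^ z * c ^ z        ≡⟨ ^-distribˡ-+-* c z z ⟨
      c ^ (z + z)          ≤⟨ ^-monoʳ-≤ c 2z≤z′ ⟩
      c ^ z′               ∎)
    where
    open ≤-Reasoning
    0<2ab : 0 < a * b * 2
    0<2ab = >-nonZero⁻¹ (a * b * 2) {{m*n≢0 (a * b) 2 {{m*n≢0 a b}}}}
  ... | inj₂ z′≤2z = <⇒≱ 2<cᶻ′ (∣⇒≤ cᶻ′∣2)
    where
    cᶻ′∣2ab : c ^ z′ ∣ a * b * 2
    cᶻ′∣2ab = ∣m+n∣m⇒∣n (subst (c ^ z′ ∣_) (trans (^-distribˡ-+-* c z z) ([cᶻ]²≡cᶻ′+2ab s s′))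
                (^-monoʳ-∣ c z′≤2z)) ∣-refl
    cᶻ′∣2 : c ^ z′ ∣ 2
    cᶻ′∣2 = coprime-divisor (coprime-^ˡ z′ (coprime-sym (coprime-*ˡ a⊥c b⊥c))) cᶻ′∣2ab
    2<cᶻ′ : 2 < c ^ z′
    2<cᶻ′ = <-≤-trans (≤-trans (s≤s 1<b) b<a) (≤-trans (n≤n^[1+k] a 1) (aˣ≤cᶻ s′))

  cᶻ∣1+b³ : Sol 1 2 z → Sol 2 1 z′ → z < z′ → c ^ z ∣ 1 + b ^ 3
  cᶻ∣1+b³ {z} {z′} (_ , _ , _ , eq) (_ , _ , _ , eq′) z<z′ =
    coprime-divisor (coprime-sym (b⊥cᶻ z))
      (∣m+n∣m⇒∣n (subst (c ^ z ∣_) identity (∣m∣n⇒∣m+n (^-monoʳ-∣ c (<⇒≤ z<z′)) (n∣m*n (b ^ 2))))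
                 (m∣m*n a))
    where
    identity : c ^ z′ + b ^ 2 * c ^ z ≡ c ^ z * a + b * (1 + b ^ 3)
    identity = begin
      c ^ z′ + b ^ 2 * c ^ z                     ≡⟨ cong₂ (λ r p → r + b ^ 2 * p) eq′ eq ⟨
      a ^ 2 + b ^ 1 + b ^ 2 * (a ^ 1 + b ^ 2)    ≡⟨ solve 2 (λ a b → a :^ 2 :+ b :^ 1 :+ b :^ 2 :* (a :^ 1 :+ b :^ 2)
                                                      := (a :^ 1 :+ b :^ 2) :* a :+ b :* (con 1 :+ b :^ 3)) refl a b ⟩
      (a ^ 1 + b ^ 2) * a + b * (1 + b ^ 3)      ≡⟨ cong (λ p → p * a + b * (1 + b ^ 3)) eq ⟩
      c ^ z * a + b * (1 + b ^ 3)                ∎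
      where open ≡-Reasoning

  z<z′⇒⊥[12,21] : Sol 1 2 z → Sol 2 1 z′ → z < z′ → ⊥
  z<z′⇒⊥[12,21] {z} s@(_ , _ , _ , eq) s′ z<z′ with cᶻ∣1+b³ s s′ z<z′
  ... | divides k 1+b³≡k*P = a≮X^ {2} (≤-<-trans a≤b³ (^-monoˡ-< 3 b<X)) (s≤s (s≤s z≤n))
    where
    open ≤-Reasoning
    P = c ^ z
    1+b²≤P : 1 + b ^ 2 ≤ P
    1+b²≤P = subst (1 + b ^ 2 ≤_) eq (+-monoˡ-≤ (b ^ 2) (m^n>0 a 1))
    k≤b : k ≤ b
    k≤b with k ≤? b
    ... | yes k≤b = k≤b
    ... | no k≰b = ⊥-elim (<-irrefl 1+b³≡k*P (begin-strict
      1 + b ^ 3                        <⟨ m<m+n (1 + b ^ 3) (≤-trans (<-trans z<s 1<b) (m≤m+n b (b ^ 2))) ⟩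
      1 + b ^ 3 + (b + b ^ 2)          ≡⟨ solve 1 (λ b → con 1 :+ b :^ 3 :+ (b :+ b :^ 2)
                                              := (con 1 :+ b) :* (con 1 :+ b :^ 2)) refl b ⟩
      (1 + b) * (1 + b ^ 2)            ≤⟨ *-mono-≤ (≰⇒> k≰b) 1+b²≤P ⟩
      k * P                            ∎))
    instance
      k≢0 : NonZero k
      k≢0 = m*n≢0⇒m≢0 k {{subst NonZero 1+b³≡k*P _}}
    a≤b³ : a ≤ b ^ 3
    a≤b³ = ≤-pred (begin-strict
      a              <⟨ a<cᶻ s ⟩
      P              ≤⟨ m≤n*m P k ⟩
      k * P          ≡⟨ 1+b³≡k*P ⟨
      1 + b ^ 3      ∎)
    b<X : b < X
    b<X = 1+b³≡k*P⇒b< {b} {k} {K} {c} {P} 1+b³≡k*P k≤b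
            (abc-unit {{b≢0}} {{m*n≢0 k c}} (m^n>0 b 3) 1+b³≡k*P
               (^-⊆ₚ b 3) (*-⊆ₚ (⊆ₚ-refl {k}) (^-⊆ₚ c z)))

  z<z′⇒⊥[1,2] : Sol 1 y z → Sol 2 y′ z′ → z < z′ → ⊥
  z<z′⇒⊥[1,2] s@(_ , 1≤y , _) s′@(_ , 1≤y′ , _) z<z′
    with 1≤n<3 1≤y (bʷ≤cᶻ⇒w<3 s′ (aˣ≤cᶻ s′) (≤-trans (bʸ≤cᶻ s) (^-monoʳ-≤ c (<⇒≤ z<z′))))
       | 1≤n<3 1≤y′ (bʷ≤cᶻ⇒w<3 s′ (aˣ≤cᶻ s′) (bʸ≤cᶻ s′))
  ... | inj₁ refl | inj₁ refl = z<z′⇒⊥[1y,2y] s s′ z<z′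
  ... | inj₂ refl | inj₂ refl = z<z′⇒⊥[1y,2y] s s′ z<z′
  ... | inj₁ refl | inj₂ refl = z<z′⇒⊥[11,22] s s′ z<z′
  ... | inj₂ refl | inj₁ refl = z<z′⇒⊥[12,21] s s′ z<z′

  z<z′⇒⊥ : Sol x y z → Sol x′ y′ z′ → z < z′ → ⊥
  z<z′⇒⊥ s s′ with x≡1⊎x≡2 s | x≡1⊎x≡2 s′
  ... | inj₁ refl | inj₁ refl = z<z′⇒⊥[1,1] s s′
  ... | inj₂ refl | inj₂ refl = z<z′⇒⊥[2,2] s s′
  ... | inj₁ refl | inj₂ refl = z<z′⇒⊥[1,2] s s′
  ... | inj₂ refl | inj₁ refl = z<z′⇒⊥[2,1] s s′

  atMostOneSol-ordered : AtMostOneSol a b c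
  atMostOneSol-ordered {z = z} {z′ = z′} s s′ with <-cmp z z′
  ... | tri< z<z′ _ _ = ⊥-elim (z<z′⇒⊥ s s′ z<z′)
  ... | tri≈ _ refl _ = let x≡x′ , y≡y′ = same-z s s′ in x≡x′ , y≡y′ , refl
  ... | tri> _ _ z>z′ = ⊥-elim (z<z′⇒⊥ s′ s z>z′)

isSol-swap : ∀ {x y z} → IsSol a b c x y z → IsSol b a c y x z
isSol-swap {a} {b} {x = x} {y} (1≤x , 1≤y , 1≤z , eq) =
  1≤y , 1≤x , 1≤z , trans (+-comm (b ^ y) (a ^ x)) eq

atMostOneSol-swap : AtMostOneSol b a c → AtMostOneSol a b c
atMostOneSol-swap unique s s′ =
  let y≡y′ , x≡x′ , z≡z′ = unique (isSol-swap s) (isSol-swap s′) in x≡x′ , y≡y′ , z≡z′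

atMostOneSol-large : RadicalAbc 1 6 K → 1 < c → 1 < a → 1 < b →
  Coprime a b → Coprime b c → Coprime a c →
  (K ^ 6 * c ^ 7) ^ 6 ≤ a ⊎ (K ^ 6 * c ^ 7) ^ 6 ≤ b → AtMostOneSol a b c
atMostOneSol-large {K} {a = a} {b = b} abc 1<c 1<a 1<b a⊥b b⊥c a⊥c N≤a⊎N≤b with <-cmp a b
... | tri< a<b _ _ =
  atMostOneSol-swap (atMostOneSol-ordered {K} abc 1<c 1<a a<b (coprime-sym a⊥b) a⊥c b⊥c
    ([ (λ N≤a → ≤-trans N≤a (<⇒≤ a<b)) , id ]′ N≤a⊎N≤b))
... | tri≈ _ refl _ = ⊥-elim (<-irrefl (sym (a⊥b (∣-refl , ∣-refl))) 1<a)
... | tri> _ _ b<a =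
  atMostOneSol-ordered {K} abc 1<c 1<b b<a a⊥b b⊥c a⊥c
    ([ id , (λ N≤b → ≤-trans N≤b (<⇒≤ b<a)) ]′ N≤a⊎N≤b)

∉-square⇒≤ : (a , b) ∉ cartesianProduct (upTo n) (upTo n) → n ≤ a ⊎ n ≤ b
∉-square⇒≤ {a} {b} {n} ∉ with a <? n | b <? n
... | yes a<n | yes b<n = ⊥-elim (∉ (∈-cartesianProduct⁺ (∈-upTo⁺ a<n) (∈-upTo⁺ b<n)))
... | no a≮n  | _       = inj₁ (≮⇒≥ a≮n)
... | yes _   | no b≮n  = inj₂ (≮⇒≥ b≮n)

corollary1 : ABC → (c : ℕ) → 1 < c →
    ∃ λ (E : List (ℕ × ℕ)) → (a b : ℕ) → 1 < a → 1 < b →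
    Coprime a b → Coprime b c → Coprime a c → (a , b) ∉ E →
    AtMostOneSol a b c
corollary1 abc c 1<c =
  let K , abc₆ = abc⇒radicalAbc abc 1 6 (s≤s z≤n) (s≤s z≤n)
      N = (K ^ 6 * c ^ 7) ^ 6
  in cartesianProduct (upTo N) (upTo N) , λ a b 1<a 1<b a⊥b b⊥c a⊥c ∉ →
       atMostOneSol-large {K} abc₆ 1<c 1<a 1<b a⊥b b⊥c a⊥c (∉-square⇒≤ ∉)
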